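{- The satisfiability problem for $\mathcal{L}$ is decidable: there is an algorithm which, given a formula $\varphi\in\mathcal{L}$, decides whether there exist a WTS $\mathcal{M}$ and a state $s$ of $\mathcal{M}$ with $\mathcal{M},s\models\varphi$.
   Context: Fix a countable set $\mathcal{AP}$ of atomic propositions. A weighted transition system (WTS) is a triple $\mathcal{M}=(S,\rightarrow,\ell)$ where $S$ is a non-empty set of states, $\rightarrow\subseteq S\times\mathbb{R}_{\ge 0}\times S$ is a transition relation (write $s\xrightarrow{r}t$), and $\ell:S\to 2^{\mathcal{AP}}$ is a labeling. For $s\in S$, $T\subseteq S$ let $\theta(s)(T)=\{r\mid \exists t\in T,\ s\xrightarrow{r}t\}$; $\theta^-(s)(T)=-\infty$ if $\theta(s)(T)=\emptyset$, else $\inf\theta(s)(T)$; $\theta^+(s)(T)=\infty$ if $\theta(s)(T)=\emptyset$, else $\sup\theta(s)(T)$. Formulae of $\mathcal{L}$: $\varphi::= p\mid\neg\varphi\mid\varphi\wedge\varphi\mid L_r\varphi\mid M_r\varphi$ with $p\in\mathcal{AP}$, $r\in\mathbb{Q}_{\ge0}$. Semantics: $\mathcal{M},s\models p$ iff $p\in\ell(s)$; Boolean cases as usual; $\mathcal{M},s\models L_r\varphi$ iff $\theta^-(s)([\![\varphi]\!])\ge r$; $\mathcal{M},s\models M_r\varphi$ iff $\theta^+(s)([\![\varphi]\!])\le r$, where $[\![\varphi]\!]=\{s\in S\mid\mathcal{M},s\models\varphi\}$. -}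

module Defs where

open import Data.Nat using (ℕ)
open import Data.Rational using (ℚ; 0ℚ; _<_; _≤_)
open import Data.Product using (Σ; proj₁; ∃; ∃-syntax; _×_; _,_)
open import Data.Sum using (_⊎_)
open import Level using (Level; 0ℓ) renaming (suc to lsuc)
open import Relation.Nullary using (¬_; Dec)
open import Function.Bundles using (_⇔_)

record ℝ : Set₁ where
  field
    lower : ℚ → Set
    upper : ℚ → Set
    lower-inhabited : ∃[ q ] lower q
    upper-inhabited : ∃[ q ] upper q
    lower-rounded : ∀ q → lower q ⇔ (∃[ p ] (q < p × lower p))
    upper-rounded : ∀ q → upper q ⇔ (∃[ p ] (p < q × upper p))
    disjoint : ∀ q → ¬ (lower q × upper q)
    located : ∀ q p → q < p → lower q ⊎ upper p

open ℝ public

-- comparisons of a real with a rational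
-- x < q  iff  q ∈ upper x ;   q < x  iff  q ∈ lower x
_≥ℚ_ : ℝ → ℚ → Set
x ≥ℚ q = ¬ upper x q

_≤ℚ_ : ℝ → ℚ → Set
x ≤ℚ q = ¬ lower x q

ℝ≥0 : Set₁
ℝ≥0 = Σ ℝ (λ x → x ≥ℚ 0ℚ)

AP : Set
AP = ℕ

-- Weighted transition systems (S, →, ℓ); 2^AP rendered as predicates on AP.
record WTS : Set₂ where
  field
    S     : Set
    _⟶[_]_ : S → ℝ≥0 → S → Set
    ℓ     : S → AP → Set
    nonempty : S

data Form : Set where
  atom : AP → Form
  ¬'_  : Form → Form
  _∧'_ : Form → Form → Form
  L    : (r : ℚ) → 0ℚ ≤ r → Form → Form
  M    : (r : ℚ) → 0ℚ ≤ r → Form → Form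

-- Semantics.
-- θ⁻(s)([[φ]]) ≥ r : θ⁻ = -∞ (which is not ≥ r) when θ(s)([[φ]]) = ∅,
--   otherwise inf θ(s)([[φ]]) ≥ r, i.e. r is a lower bound of θ(s)([[φ]]).
-- θ⁺(s)([[φ]]) ≤ r : θ⁺ = ∞ (which is not ≤ r) when θ(s)([[φ]]) = ∅,
--   otherwise sup θ(s)([[φ]]) ≤ r, i.e. r is an upper bound of θ(s)([[φ]]).

module _ (𝓜 : WTS) where
  open WTS 𝓜

  _⊨_ : S → Form → Set₁
  s ⊨ atom p  = Level.Lift _ (ℓ s p)
  s ⊨ (¬' φ)  = ¬ (s ⊨ φ)
  s ⊨ (φ ∧' ψ) = (s ⊨ φ) × (s ⊨ ψ)
  s ⊨ L r _ φ =
    (∃[ w ] ∃[ t ] (s ⟶[ w ] t × t ⊨ φ)) ×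
    (∀ w t → s ⟶[ w ] t → t ⊨ φ → proj₁ w ≥ℚ r)
  s ⊨ M r _ φ =
    (∃[ w ] ∃[ t ] (s ⟶[ w ] t × t ⊨ φ)) ×
    (∀ w t → s ⟶[ w ] t → t ⊨ φ → proj₁ w ≤ℚ r)

_⊨⟨_⟩_ : (𝓜 : WTS) → WTS.S 𝓜 → Form → Set₁
𝓜 ⊨⟨ s ⟩ φ = _⊨_ 𝓜 s φ

Satisfiable : Form → Set₂
Satisfiable φ = Σ WTS (λ 𝓜 → Σ (WTS.S 𝓜) (λ s → 𝓜 ⊨⟨ s ⟩ φ))

-- A formula is satisfiable iff some branch of its disjunctive normal form is, a branch being a
-- list of signed atoms and signed modal literals L_r ψ, M_r ψ. Fix the bodies ψ₁ … ψ_k of the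
-- modal literals of a branch. A successor of a state is classified by its type, the set T of
-- bodies it satisfies, and by its weight, which the positive literals with body in T confine to an
-- interval with rational endpoints. The branch is satisfiable iff its atoms are consistent and,
-- for some set A of bodies (those holding at some successor), every literal is met by types
-- T ⊆ A whose interval is nonempty and which are themselves satisfiable; the latter is decided
-- recursively, since the formulas describing a type have smaller modal depth. Only finitely many
-- A and T exist, and an interval with rational endpoints contains a real weight on one side of a
-- rational r iff it contains a rational one there, so this is a finite search. For the converse,
-- a root with an edge of every admissible rational weight to a model of each viable type
-- satisfies the branch. The classical step (every state has a type) is only needed under double
-- negation: a negative answer just has to refute every model.

module Submission where

open import Defs
open import Data.Bool using (Bool; true; false; not)
open import Data.Empty using (⊥; ⊥-elim)
open import Data.Fin using (Fin; zero; suc)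
open import Data.Fin.Subset using (Subset; _∈_; _∉_; _⊆_; inside; outside)
open import Data.Fin.Subset.Properties using (_∈?_; _⊆?_; anySubset?)
open import Data.Fin.Properties using (all?)
open import Data.List
  using (List; []; _∷_; _++_; [_]; map; foldr; tabulate; cartesianProductWith; lookup)
open import Data.List.Properties using (tabulate-lookup)
open import Data.List.Membership.Propositional.Properties using (∈-lookup)
open import Data.List.Relation.Unary.All as All using (All; []; _∷_)
import Data.List.Relation.Unary.All.Properties as All
open import Data.List.Relation.Unary.Any as Any using (Any; here)
import Data.List.Relation.Unary.Any.Properties as Any
open import Data.Nat as ℕ using (ℕ; zero; suc)
import Data.Nat.Properties as ℕ
open import Data.List.Membership.DecPropositional ℕ._≟_
  using () renaming (_∈?_ to _∈ᴸ?_; _∈_ to _∈ᴸ_; _∉_ to _∉ᴸ_)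
open import Data.Product using (Σ-syntax; ∃-syntax; _×_; _,_; proj₁; proj₂)
open import Data.Product.Function.NonDependent.Propositional using (_×-⇔_)
open import Data.Rational using (ℚ; 0ℚ; 1ℚ; _<_; _≤_; _+_; _-_; -_; _⊔_)
open import Data.Rational.Properties
open import Data.Sum using (_⊎_; inj₁; inj₂; [_,_]′)
open import Data.Unit using (⊤; tt)
open import Data.Vec as Vec using ([]; _∷_)
import Data.Vec.Properties as Vec
open import Function using (_∘_; id; case_of_)
open import Function.Bundles using (_⇔_; mk⇔; Equivalence)
open import Function.Properties.Equivalence using () renaming (trans to ⇔-trans)
open import Level using (lift; lower)
open import Relation.Binary.Bundles using (DecTotalOrder)
open import Relation.Binary.Definitions using (tri<; tri≈; tri>)
open import Relation.Binary.PropositionalEquality using (_≡_; refl; sym; subst; setoid)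
open import Relation.Nullary using (¬_; Dec; yes; no; does)
open import Relation.Nullary.Decidable
  using (True; toWitness; fromWitness; _×-dec_; _⊎-dec_; ¬?; map′; ¬¬-excluded-middle)
open import Relation.Nullary.Negation using (¬¬-map)

open import Data.List.Extrema (DecTotalOrder.totalOrder ≤-decTotalOrder)
  using (max; min; ⊥≤max; xs≤max; max≤v⁺; min≤xs; v≤min⁺; argmin-all; argmax-all)

open Equivalence using (to; from)

-- Double negation and finite subsets

¬¬-shift : ∀ {p n} {P : Fin n → Set p} → (∀ i → ¬ ¬ P i) → ¬ ¬ (∀ i → P i)
¬¬-shift {n = zero} _ k = k (λ ())
¬¬-shift {n = suc n} ¬¬P k =
  ¬¬P zero (λ P₀ → ¬¬-shift (¬¬P ∘ suc) (λ P₊ → k λ { zero → P₀ ; (suc i) → P₊ i }))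

fromDec : ∀ {p n} {P : Fin n → Set p} → (∀ i → Dec (P i)) → Subset n
fromDec d = Vec.tabulate (does ∘ d)

∈-fromDec : ∀ {p n} {P : Fin n → Set p} (d : ∀ i → Dec (P i)) i → i ∈ fromDec d ⇔ P i
∈-fromDec d zero with d zero
... | yes p = mk⇔ (λ _ → p) (λ _ → Vec.here)
... | no ¬p = mk⇔ (λ ()) (⊥-elim ∘ ¬p)
∈-fromDec d (suc i) = mk⇔ (λ { (Vec.there m) → to (∈-fromDec (d ∘ suc) i) m })
                          (Vec.there ∘ from (∈-fromDec (d ∘ suc) i))

¬¬-comprehension : ∀ {p n} (P : Fin n → Set p) → ¬ ¬ (Σ[ S ∈ Subset n ] ∀ i → i ∈ S ⇔ P i)
¬¬-comprehension P = ¬¬-map (λ d → fromDec d , ∈-fromDec d) (¬¬-shift (λ _ → ¬¬-excluded-middle))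

map-¬¬ : ∀ {a b} {A : Set a} {B : Set b} → (A → B) → (B → ¬ ¬ A) → Dec A → Dec B
map-¬¬ A⇒B _    (yes a)  = yes (A⇒B a)
map-¬¬ _   B⇒¬¬A (no ¬a) = no (λ b → B⇒¬¬A b ¬a)

any-dec : ∀ {a p} {A : Set a} {P : A → Set p} {xs} → All (λ x → Dec (P x)) xs → Dec (Any P xs)
any-dec []       = no λ ()
any-dec (d ∷ ds) = map′ Any.fromSum Any.toSum (d ⊎-dec any-dec ds)

collect : ∀ {a n} {A : Set a} → Subset n → (Fin n → List A) → List A
collect []            f = []
collect (inside  ∷ T) f = f zero ++ collect T (f ∘ suc)
collect (outside ∷ T) f = collect T (f ∘ suc)

module _ {a p} {A : Set a} {P : A → Set p} where

  All-collect⁺ : ∀ {n} (T : Subset n) {f} → (∀ {i} → i ∈ T → All P (f i)) → All P (collect T f)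
  All-collect⁺ []            f✓ = []
  All-collect⁺ (inside  ∷ T) f✓ = All.++⁺ (f✓ Vec.here) (All-collect⁺ T (f✓ ∘ Vec.there))
  All-collect⁺ (outside ∷ T) f✓ = All-collect⁺ T (f✓ ∘ Vec.there)

  All-collect⁻ : ∀ {n} (T : Subset n) {f} → All P (collect T f) → ∀ {i} → i ∈ T → All P (f i)
  All-collect⁻ (inside  ∷ T) {f} f✓ Vec.here      = All.++⁻ˡ (f zero) f✓
  All-collect⁻ (inside  ∷ T) {f} f✓ (Vec.there i∈T) = All-collect⁻ T (All.++⁻ʳ (f zero) f✓) i∈T
  All-collect⁻ (outside ∷ T)     f✓ (Vec.there i∈T) = All-collect⁻ T f✓ i∈T

-- Rationals as real numbers

p<p+1 : ∀ p → p < p + 1ℚ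
p<p+1 p = subst (_< p + 1ℚ) (+-identityʳ p) (+-monoʳ-< p (positive⁻¹ 1ℚ))

p-1<p : ∀ p → p - 1ℚ < p
p-1<p p = subst (p - 1ℚ <_) (+-identityʳ p) (+-monoʳ-< p (negative⁻¹ (- 1ℚ)))

fromℚ : ℚ → ℝ
fromℚ q = record
  { lower           = _< q
  ; upper           = q <_
  ; lower-inhabited = q - 1ℚ , p-1<p q
  ; upper-inhabited = q + 1ℚ , p<p+1 q
  ; lower-rounded   = λ p → mk⇔ <-dense (λ (_ , p<r , r<q) → <-trans p<r r<q)
  ; upper-rounded   = λ p → mk⇔ (λ q<p → let (r , q<r , r<p) = <-dense q<p in r , r<p , q<r)
                                (λ (_ , r<p , q<r) → <-trans q<r r<p)
  ; disjoint        = λ _ (p<q , q<p) → <-asym p<q q<p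
  ; located         = located′
  }
  where
  located′ : ∀ p p′ → p < p′ → p < q ⊎ q < p′
  located′ p p′ p<p′ with <-cmp p q
  ... | tri< p<q _ _ = inj₁ p<q
  ... | tri≈ _ refl _ = inj₂ p<p′
  ... | tri> _ _ q<p = inj₂ (<-trans q<p p<p′)

≤⇒≯ : ∀ {p q} → p ≤ q → ¬ q < p
≤⇒≯ p≤q q<p = <-irrefl refl (<-≤-trans q<p p≤q)

module _ (x : ℝ) where

  upper-≤ : ∀ {p q} → upper x p → p ≤ q → upper x q
  upper-≤ {p} {q} x<p p≤q with <-cmp p q
  ... | tri< p<q _ _ = from (upper-rounded x q) (p , p<q , x<p)
  ... | tri≈ _ refl _ = x<p
  ... | tri> _ _ q<p = ⊥-elim (≤⇒≯ p≤q q<p)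

  lower-≥ : ∀ {p q} → lower x p → q ≤ p → lower x q
  lower-≥ {p} {q} p<x q≤p with <-cmp q p
  ... | tri< q<p _ _ = from (lower-rounded x q) (p , q<p , p<x)
  ... | tri≈ _ refl _ = p<x
  ... | tri> _ _ p<q = ⊥-elim (≤⇒≯ q≤p p<q)

  ≥ℚ∧≤ℚ⇒≤ : ∀ {p q} → x ≥ℚ p → x ≤ℚ q → p ≤ q
  ≥ℚ∧≤ℚ⇒≤ {p} {q} x≥p x≤q = ≮⇒≥ λ q<p → [ x≤q , x≥p ]′ (located x q p q<p)

  ≥ℚ∧upper⇒< : ∀ {p q} → x ≥ℚ p → upper x q → p < q
  ≥ℚ∧upper⇒< x≥p x<q = ≰⇒> λ q≤p → x≥p (upper-≤ x<q q≤p)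

  ≤ℚ∧lower⇒> : ∀ {p q} → x ≤ℚ p → lower x q → q < p
  ≤ℚ∧lower⇒> x≤p q<x = ≰⇒> λ p≤q → x≤p (lower-≥ q<x p≤q)

_≃ℚ_ : ℝ → ℚ → Set
x ≃ℚ q = (∀ p → upper x p → q < p) × (∀ p → lower x p → p < q)

fromℚ-≃ℚ : ∀ q → fromℚ q ≃ℚ q
fromℚ-≃ℚ q = (λ _ → id) , (λ _ → id)

-- Intervals with finitely many rational bounds

data Bound : Set where
  atLeast atMost : (r : ℚ) → 0ℚ ≤ r → Bound

Violates : Bound → ℝ → Set
Violates (atLeast r _) x = upper x r
Violates (atMost  r _) x = lower x r

≃ℚ-violates : ∀ {x q} b → x ≃ℚ q → Violates b x → Violates b (fromℚ q)
≃ℚ-violates (atLeast r _) (x<⇒q< , _) = x<⇒q< r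
≃ℚ-violates (atMost  r _) (_ , <x⇒<q) = <x⇒<q r

module Interval (ls us : List ℚ) where

  record Contains (x : ℝ) : Set where
    constructor contains
    field
      nonNegative : x ≥ℚ 0ℚ
      aboveLower  : All (x ≥ℚ_) ls
      belowUpper  : All (x ≤ℚ_) us

  least : ℚ
  least = max 0ℚ ls

  NonEmpty : Set
  NonEmpty = All (least ≤_) us

  CanViolate : Bound → Set
  CanViolate (atLeast r _) = least < r
  CanViolate (atMost  r _) = All (r <_) us

  contains⇒nonEmpty : ∀ {x} → Contains x → NonEmpty
  contains⇒nonEmpty {x} (contains x≥0 x≥ls x≤us) = All.map least≤ x≤us
    where
    least≤ : ∀ {u} → x ≤ℚ u → least ≤ u
    least≤ x≤u = max≤v⁺ (≥ℚ∧≤ℚ⇒≤ x x≥0 x≤u) (All.map (λ x≥l → ≥ℚ∧≤ℚ⇒≤ x x≥l x≤u) x≥ls)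

  contains-least : NonEmpty → Contains (fromℚ least)
  contains-least least≤us =
    contains (≤⇒≯ (⊥≤max 0ℚ ls)) (All.map ≤⇒≯ (xs≤max 0ℚ ls)) (All.map ≤⇒≯ least≤us)

  contains⇒canViolate : ∀ {x} b → Contains x → Violates b x → CanViolate b
  contains⇒canViolate {x} (atLeast r _) (contains x≥0 x≥ls _) x<r =
    argmax-all id (≥ℚ∧upper⇒< x x≥0 x<r) (All.map (λ x≥l → ≥ℚ∧upper⇒< x x≥l x<r) x≥ls)
  contains⇒canViolate {x} (atMost r _) (contains _ _ x≤us) r<x =
    All.map (λ x≤u → ≤ℚ∧lower⇒> x x≤u r<x) x≤us

  violatingPoint : ∀ b → NonEmpty → CanViolate b →
                   Σ[ q ∈ ℚ ] Contains (fromℚ q) × Violates b (fromℚ q)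
  violatingPoint (atLeast r _) least≤us least<r = least , contains-least least≤us , least<r
  violatingPoint (atMost r _) least≤us r<us =
    q , contains (≤⇒≯ 0≤q) (All.map (λ l≤least → ≤⇒≯ (≤-trans l≤least least≤q)) (xs≤max 0ℚ ls))
                 (All.map ≤⇒≯ (min≤xs d us)) , r<q
    where
    d q : ℚ
    d = least ⊔ (r + 1ℚ)
    q = min d us
    least≤q : least ≤ q
    least≤q = v≤min⁺ (p≤p⊔q least _) least≤us
    0≤q : 0ℚ ≤ q
    0≤q = ≤-trans (⊥≤max 0ℚ ls) least≤q
    r<q : r < q
    r<q = argmin-all id (<-≤-trans (p<p+1 r) (p≤q⊔p least _)) r<us

  nonEmpty? : Dec NonEmpty
  nonEmpty? = All.all? (least ≤?_) us

  canViolate? : ∀ b → Dec (CanViolate b)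
  canViolate? (atLeast r _) = least <? r
  canViolate? (atMost r _)  = All.all? (r <?_) us

-- Bounded morphisms

HasSuccessor : (𝓜 : WTS) → WTS.S 𝓜 → Form → Set₁
HasSuccessor 𝓜 s φ = ∃[ w ] ∃[ t ] (WTS._⟶[_]_ 𝓜 s w t × 𝓜 ⊨⟨ t ⟩ φ)

record BoundedMorphism (𝓜 𝓝 : WTS) : Set₁ where
  field
    ⟦_⟧   : WTS.S 𝓜 → WTS.S 𝓝
    label : ∀ s p → WTS.ℓ 𝓜 s p ⇔ WTS.ℓ 𝓝 ⟦ s ⟧ p
    forth : ∀ {s w t} → WTS._⟶[_]_ 𝓜 s w t → WTS._⟶[_]_ 𝓝 ⟦ s ⟧ w ⟦ t ⟧
    back  : ∀ {s w u} → WTS._⟶[_]_ 𝓝 ⟦ s ⟧ w u → ∃[ t ] (WTS._⟶[_]_ 𝓜 s w t × ⟦ t ⟧ ≡ u)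

module _ {𝓜 𝓝 : WTS} (f : BoundedMorphism 𝓜 𝓝) where
  open BoundedMorphism f
  private
    module 𝓜 = WTS 𝓜
    module 𝓝 = WTS 𝓝

  module _ {φ : Form} (⊨φ : ∀ {t} → 𝓜 ⊨⟨ t ⟩ φ ⇔ 𝓝 ⊨⟨ ⟦ t ⟧ ⟩ φ) {s : 𝓜.S} where

    successor-preserved : HasSuccessor 𝓜 s φ ⇔ HasSuccessor 𝓝 ⟦ s ⟧ φ
    successor-preserved = mk⇔
      (λ (w , t , s⟶t , t⊨φ) → w , ⟦ t ⟧ , forth s⟶t , to ⊨φ t⊨φ)
      (λ (w , u , s⟶u , u⊨φ) → let (t , s⟶t , ⟦t⟧≡u) = back s⟶u in
        w , t , s⟶t , from ⊨φ (subst (𝓝 ⊨⟨_⟩ φ) (sym ⟦t⟧≡u) u⊨φ))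

    successors-preserved : {R : ℝ≥0 → Set} →
      (∀ w t → 𝓜._⟶[_]_ s w t → 𝓜 ⊨⟨ t ⟩ φ → R w) ⇔ (∀ w u → 𝓝._⟶[_]_ ⟦ s ⟧ w u → 𝓝 ⊨⟨ u ⟩ φ → R w)
    successors-preserved = mk⇔
      (λ all w u s⟶u u⊨φ → let (t , s⟶t , ⟦t⟧≡u) = back s⟶u in
        all w t s⟶t (from ⊨φ (subst (𝓝 ⊨⟨_⟩ φ) (sym ⟦t⟧≡u) u⊨φ)))
      (λ all w t s⟶t t⊨φ → all w ⟦ t ⟧ (forth s⟶t) (to ⊨φ t⊨φ))

  ⊨-preserved : ∀ φ {s} → 𝓜 ⊨⟨ s ⟩ φ ⇔ 𝓝 ⊨⟨ ⟦ s ⟧ ⟩ φ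
  ⊨-preserved (atom p) {s} =
    mk⇔ (λ (lift ℓ) → lift (to (label s p) ℓ)) (λ (lift ℓ) → lift (from (label s p) ℓ))
  ⊨-preserved (¬' φ) = mk⇔ (λ ¬h h → ¬h (from (⊨-preserved φ) h)) (λ ¬h h → ¬h (to (⊨-preserved φ) h))
  ⊨-preserved (φ ∧' ψ) = ⊨-preserved φ ×-⇔ ⊨-preserved ψ
  ⊨-preserved (L _ _ φ) = successor-preserved (⊨-preserved φ) ×-⇔ successors-preserved (⊨-preserved φ)
  ⊨-preserved (M _ _ φ) = successor-preserved (⊨-preserved φ) ×-⇔ successors-preserved (⊨-preserved φ)

-- Literals and the disjunctive normal form

signed : Bool → Form → Form
signed true  φ = φ
signed false φ = ¬' φ

boundedForm : Bound → Form → Form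
boundedForm (atLeast r r≥0) = L r r≥0
boundedForm (atMost  r r≥0) = M r r≥0

record ModalLit : Set where
  constructor modalLit
  field
    sign  : Bool
    bound : Bound
    body  : Form

open ModalLit

modalForm : ModalLit → Form
modalForm m = signed (sign m) (boundedForm (bound m) (body m))

data Lit : Set where
  atomic : Bool → AP → Lit
  modal  : ModalLit → Lit

litForm : Lit → Form
litForm (atomic σ p) = signed σ (atom p)
litForm (modal m)    = modalForm m

Branch : Set
Branch = List Lit

_⊗_ : List Branch → List Branch → List Branch
_⊗_ = cartesianProductWith _++_

expand : Bool → Form → List Branch
expand σ     (atom p)   = [ [ atomic σ p ] ]
expand σ     (¬' φ)     = expand (not σ) φ
expand true  (φ ∧' ψ)   = expand true φ ⊗ expand true ψ
expand false (φ ∧' ψ)   = expand false φ ++ expand false ψ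
expand σ     (L r r≥0 φ) = [ [ modal (modalLit σ (atLeast r r≥0) φ) ] ]
expand σ     (M r r≥0 φ) = [ [ modal (modalLit σ (atMost r r≥0) φ) ] ]

expand⋀ : List Form → List Branch
expand⋀ = foldr (λ φ bs → expand true φ ⊗ bs) [ [] ]

Satisfiable⋀ : List Form → Set₂
Satisfiable⋀ Γ = Σ[ 𝓜 ∈ WTS ] Σ[ s ∈ WTS.S 𝓜 ] All (𝓜 ⊨⟨ s ⟩_) Γ

module _ (𝓜 : WTS) (s : WTS.S 𝓜) where

  Holds : Branch → Set₁
  Holds = All (λ l → 𝓜 ⊨⟨ s ⟩ litForm l)

  ⊗-holds⁺ : ∀ {xs ys} → Any Holds xs → Any Holds ys → Any Holds (xs ⊗ ys)
  ⊗-holds⁺ = Any.cartesianProductWith⁺ _++_ All.++⁺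

  ⊗-holds⁻ : ∀ xs ys → Any Holds (xs ⊗ ys) → Any Holds xs × Any Holds ys
  ⊗-holds⁻ = Any.cartesianProductWith⁻ _++_ (λ {b} → All.++⁻ b)

  expand-sound : ∀ σ φ → Any Holds (expand σ φ) → 𝓜 ⊨⟨ s ⟩ signed σ φ
  expand-sound σ     (atom p)  (here (h ∷ [])) = h
  expand-sound true  (¬' φ)    h = expand-sound false φ h
  expand-sound false (¬' φ)    h = λ ¬φ → ¬φ (expand-sound true φ h)
  expand-sound true  (φ ∧' ψ)  h =
    let hφ , hψ = ⊗-holds⁻ (expand true φ) _ h in expand-sound true φ hφ , expand-sound true ψ hψ
  expand-sound false (φ ∧' ψ)  h with Any.++⁻ (expand false φ) h
  ... | inj₁ hφ = λ (φ✓ , _) → expand-sound false φ hφ φ✓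
  ... | inj₂ hψ = λ (_ , ψ✓) → expand-sound false ψ hψ ψ✓
  expand-sound σ     (L _ _ _) (here (h ∷ [])) = h
  expand-sound σ     (M _ _ _) (here (h ∷ [])) = h

  expand-complete : ∀ σ φ → 𝓜 ⊨⟨ s ⟩ signed σ φ → ¬ ¬ Any Holds (expand σ φ)
  expand-complete σ     (atom p)  h k = k (here (h ∷ []))
  expand-complete true  (¬' φ)    h = expand-complete false φ h
  expand-complete false (¬' φ)    h k = h (λ φ✓ → expand-complete true φ φ✓ k)
  expand-complete true  (φ ∧' ψ)  (φ✓ , ψ✓) k =
    expand-complete true φ φ✓ λ hφ → expand-complete true ψ ψ✓ λ hψ → k (⊗-holds⁺ hφ hψ)
  expand-complete false (φ ∧' ψ)  h k =
    expand-complete false φ (λ φ✓ → expand-complete false ψ (λ ψ✓ → h (φ✓ , ψ✓))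
                                      (k ∘ Any.++⁺ʳ (expand false φ)))
                            (k ∘ Any.++⁺ˡ)
  expand-complete σ     (L _ _ _) h k = k (here (h ∷ []))
  expand-complete σ     (M _ _ _) h k = k (here (h ∷ []))

  expand⋀-sound : ∀ Γ → Any Holds (expand⋀ Γ) → All (𝓜 ⊨⟨ s ⟩_) Γ
  expand⋀-sound []      _ = []
  expand⋀-sound (φ ∷ Γ) h =
    let hφ , hΓ = ⊗-holds⁻ (expand true φ) _ h in expand-sound true φ hφ ∷ expand⋀-sound Γ hΓ

  expand⋀-complete : ∀ Γ → All (𝓜 ⊨⟨ s ⟩_) Γ → ¬ ¬ Any Holds (expand⋀ Γ)
  expand⋀-complete []      []        k = k (here [])
  expand⋀-complete (φ ∷ Γ) (φ✓ ∷ Γ✓) k =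
    expand-complete true φ φ✓ λ hφ → expand⋀-complete Γ Γ✓ λ hΓ → k (⊗-holds⁺ hφ hΓ)

someBranch⇒satisfiable : ∀ Γ → Any (Satisfiable⋀ ∘ map litForm) (expand⋀ Γ) → Satisfiable⋀ Γ
someBranch⇒satisfiable Γ some✓ =
  let (𝓜 , some✓′) = Any.Any-Σ⁻ʳ some✓
      (s , some✓″) = Any.Any-Σ⁻ʳ some✓′
  in 𝓜 , s , expand⋀-sound 𝓜 s Γ (Any.map All.map⁻ some✓″)

satisfiable⇒¬¬someBranch : ∀ Γ → Satisfiable⋀ Γ → ¬ ¬ Any (Satisfiable⋀ ∘ map litForm) (expand⋀ Γ)
satisfiable⇒¬¬someBranch Γ (𝓜 , s , Γ✓) =
  ¬¬-map (Any.map λ b✓ → 𝓜 , s , All.map⁺ b✓) (expand⋀-complete 𝓜 s Γ Γ✓)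

module _ {𝓜 : WTS} {s : WTS.S 𝓜} where

  ⊨-signed : ∀ σ {φ} → (σ ≡ true ⇔ 𝓜 ⊨⟨ s ⟩ φ) ⇔ 𝓜 ⊨⟨ s ⟩ signed σ φ
  ⊨-signed true  = mk⇔ (λ σ⇔φ → to σ⇔φ refl) (λ φ✓ → mk⇔ (λ _ → φ✓) (λ _ → refl))
  ⊨-signed false = mk⇔ (λ σ⇔φ φ✓ → case from σ⇔φ φ✓ of λ ()) (λ ¬φ → mk⇔ (λ ()) (⊥-elim ∘ ¬φ))

  ⊨-bounded : ∀ b {φ} → 𝓜 ⊨⟨ s ⟩ boundedForm b φ ⇔
              (HasSuccessor 𝓜 s φ × (∀ w t → WTS._⟶[_]_ 𝓜 s w t → 𝓜 ⊨⟨ t ⟩ φ → ¬ Violates b (proj₁ w)))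
  ⊨-bounded (atLeast _ _) = mk⇔ id id
  ⊨-bounded (atMost  _ _) = mk⇔ id id

lowerBound upperBound : ModalLit → List ℚ
lowerBound (modalLit true (atLeast r _) _) = [ r ]
lowerBound _                               = []
upperBound (modalLit true (atMost r _) _)  = [ r ]
upperBound _                               = []

Respects : ModalLit → ℝ → Set
Respects m x = All (x ≥ℚ_) (lowerBound m) × All (x ≤ℚ_) (upperBound m)

⊨⇒respects : ∀ {𝓜 s w t} m → 𝓜 ⊨⟨ s ⟩ modalForm m → WTS._⟶[_]_ 𝓜 s w t → 𝓜 ⊨⟨ t ⟩ body m →
             Respects m (proj₁ w)
⊨⇒respects (modalLit true  (atLeast _ _) _) (_ , all) s⟶t t✓ = all _ _ s⟶t t✓ ∷ [] , []
⊨⇒respects (modalLit true  (atMost  _ _) _) (_ , all) s⟶t t✓ = [] , all _ _ s⟶t t✓ ∷ []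
⊨⇒respects (modalLit false _             _) _         _   _  = [] , []

respects⇒¬violates : ∀ {x} m → sign m ≡ true → Respects m x → ¬ Violates (bound m) x
respects⇒¬violates (modalLit true (atLeast _ _) _) _ (x≥r ∷ [] , []) = x≥r
respects⇒¬violates (modalLit true (atMost  _ _) _) _ ([] , x≤r ∷ []) = x≤r

posAtoms negAtoms : Branch → List AP
posAtoms []                  = []
posAtoms (atomic true  p ∷ b) = p ∷ posAtoms b
posAtoms (_              ∷ b) = posAtoms b
negAtoms []                  = []
negAtoms (atomic false p ∷ b) = p ∷ negAtoms b
negAtoms (_              ∷ b) = negAtoms b

modalLits : Branch → List ModalLit
modalLits []             = []
modalLits (modal m ∷ b)  = m ∷ modalLits b
modalLits (atomic _ _ ∷ b) = modalLits b

module _ {p} {P : Lit → Set p} where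

  All-posAtoms : ∀ {b} → All P b → All (P ∘ atomic true) (posAtoms b)
  All-posAtoms {[]}                 []       = []
  All-posAtoms {atomic true  _ ∷ _} (l ∷ ls) = l ∷ All-posAtoms ls
  All-posAtoms {atomic false _ ∷ _} (_ ∷ ls) = All-posAtoms ls
  All-posAtoms {modal _        ∷ _} (_ ∷ ls) = All-posAtoms ls

  All-negAtoms : ∀ {b} → All P b → All (P ∘ atomic false) (negAtoms b)
  All-negAtoms {[]}                 []       = []
  All-negAtoms {atomic true  _ ∷ _} (_ ∷ ls) = All-negAtoms ls
  All-negAtoms {atomic false _ ∷ _} (l ∷ ls) = l ∷ All-negAtoms ls
  All-negAtoms {modal _        ∷ _} (_ ∷ ls) = All-negAtoms ls

  All-modalLits : ∀ {b} → All P b → All (P ∘ modal) (modalLits b)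
  All-modalLits {[]}              []       = []
  All-modalLits {atomic _ _ ∷ _} (_ ∷ ls) = All-modalLits ls
  All-modalLits {modal _    ∷ _} (l ∷ ls) = l ∷ All-modalLits ls

  All-join : ∀ b → All (P ∘ atomic true) (posAtoms b) → All (P ∘ atomic false) (negAtoms b) →
             All (P ∘ modal) (modalLits b) → All P b
  All-join []                   []       []       []       = []
  All-join (atomic true  _ ∷ b) (l ∷ ps) ns       ms       = l ∷ All-join b ps ns ms
  All-join (atomic false _ ∷ b) ps       (l ∷ ns) ms       = l ∷ All-join b ps ns ms
  All-join (modal _        ∷ b) ps       ns       (l ∷ ms) = l ∷ All-join b ps ns ms

depth : Form → ℕ
depth (atom _)  = 0
depth (¬' φ)    = depth φ
depth (φ ∧' ψ)  = depth φ ℕ.⊔ depth ψ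
depth (L _ _ φ) = suc (depth φ)
depth (M _ _ φ) = suc (depth φ)

module _ {n : ℕ} where

  Shallow : Lit → Set
  Shallow l = depth (litForm l) ℕ.< n

  signed-depth : ∀ σ {φ} → depth φ ℕ.< n → depth (signed σ φ) ℕ.< n
  signed-depth true  = id
  signed-depth false = id

  ⊗-shallow : ∀ {xs ys} → All (All Shallow) xs → All (All Shallow) ys → All (All Shallow) (xs ⊗ ys)
  ⊗-shallow {xs} {ys} xs✓ ys✓ = All.cartesianProductWith⁺ (setoid Branch) (setoid Branch) _++_ xs ys
    (λ x∈xs y∈ys → All.++⁺ (All.lookup xs✓ x∈xs) (All.lookup ys✓ y∈ys))

  expand-shallow : ∀ σ φ → depth φ ℕ.< n → All (All Shallow) (expand σ φ)
  expand-shallow σ     (atom p)  d = (signed-depth σ d ∷ []) ∷ []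
  expand-shallow σ     (¬' φ)    d = expand-shallow (not σ) φ d
  expand-shallow true  (φ ∧' ψ)  d =
    ⊗-shallow (expand-shallow true φ (ℕ.m⊔n<o⇒m<o _ _ d)) (expand-shallow true ψ (ℕ.m⊔n<o⇒n<o _ _ d))
  expand-shallow false (φ ∧' ψ)  d =
    All.++⁺ (expand-shallow false φ (ℕ.m⊔n<o⇒m<o _ _ d)) (expand-shallow false ψ (ℕ.m⊔n<o⇒n<o _ _ d))
  expand-shallow σ     (L _ _ _) d = (signed-depth σ d ∷ []) ∷ []
  expand-shallow σ     (M _ _ _) d = (signed-depth σ d ∷ []) ∷ []

  expand⋀-shallow : ∀ {Γ} → All (λ φ → depth φ ℕ.< n) Γ → All (All Shallow) (expand⋀ Γ)
  expand⋀-shallow {[]}    []       = [] ∷ []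
  expand⋀-shallow {φ ∷ Γ} (d ∷ ds) = ⊗-shallow (expand-shallow true φ d) (expand⋀-shallow ds)

depth-modalForm : ∀ m → depth (modalForm m) ≡ suc (depth (body m))
depth-modalForm (modalLit true  (atLeast _ _) _) = refl
depth-modalForm (modalLit true  (atMost  _ _) _) = refl
depth-modalForm (modalLit false (atLeast _ _) _) = refl
depth-modalForm (modalLit false (atMost  _ _) _) = refl

modalLits-depth : ∀ {n b} → All (Shallow {suc n}) b → ∀ i → depth (body (lookup (modalLits b) i)) ℕ.< n
modalLits-depth {b = b} b-depth i =
  ℕ.≤-pred (subst (ℕ._< _) (depth-modalForm (lookup (modalLits b) i))
                 (All.lookup (All-modalLits b-depth) (∈-lookup i)))

-- One modal step

module LocalStep {k : ℕ} (lit : Fin k → ModalLit) where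

  ψ : Fin k → Form
  ψ i = body (lit i)

  typeForms : Subset k → List Form
  typeForms T = tabulate (λ i → signed (Vec.lookup T i) (ψ i))

  typeForms-depth : ∀ {n} → (∀ i → depth (ψ i) ℕ.< n) → ∀ T → All (λ φ → depth φ ℕ.< n) (typeForms T)
  typeForms-depth ψ✓ T = All.tabulate⁺ (λ i → signed-depth (Vec.lookup T i) (ψ✓ i))

  Realises : (𝓜 : WTS) → WTS.S 𝓜 → Subset k → Set₁
  Realises 𝓜 t T = ∀ i → i ∈ T ⇔ 𝓜 ⊨⟨ t ⟩ ψ i

  realises⇔typeForms : ∀ {𝓜 t T} → Realises 𝓜 t T ⇔ All (𝓜 ⊨⟨ t ⟩_) (typeForms T)
  realises⇔typeForms {T = T} = mk⇔
    (λ T✓ → All.tabulate⁺ λ i → to (⊨-signed (Vec.lookup T i))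
      (mk⇔ (to (T✓ i) ∘ Vec.lookup⇒[]= i T) (Vec.[]=⇒lookup ∘ from (T✓ i))))
    (λ T✓ i → let σ⇔ψ = from (⊨-signed (Vec.lookup T i)) (All.tabulate⁻ T✓ i) in
      mk⇔ (to σ⇔ψ ∘ Vec.[]=⇒lookup) (Vec.lookup⇒[]= i T ∘ from σ⇔ψ))

  lowerBounds upperBounds : Subset k → List ℚ
  lowerBounds T = collect T (lowerBound ∘ lit)
  upperBounds T = collect T (upperBound ∘ lit)

  module Weights (T : Subset k) = Interval (lowerBounds T) (upperBounds T)
  open Weights using (NonEmpty; CanViolate)

  Admissible : Subset k → ℝ → Set
  Admissible = Weights.Contains

  admissible⁺ : ∀ {T x} → x ≥ℚ 0ℚ → (∀ {i} → i ∈ T → Respects (lit i) x) → Admissible T x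
  admissible⁺ {T} x≥0 respects =
    Weights.contains {T} x≥0 (All-collect⁺ T (proj₁ ∘ respects)) (All-collect⁺ T (proj₂ ∘ respects))

  admissible⁻ : ∀ {T x i} → Admissible T x → i ∈ T → Respects (lit i) x
  admissible⁻ {T} (Weights.contains _ x≥ls x≤us) i∈T =
    All-collect⁻ T x≥ls i∈T , All-collect⁻ T x≤us i∈T

  Viable : Subset k → Subset k → Set₂
  Viable A T = T ⊆ A × NonEmpty T × Satisfiable⋀ (typeForms T)

  -- A is meant to be the set of bodies holding at some successor, T the type of a successor.
  LitCond : Subset k → Fin k → Bool → Bound → Set₂
  LitCond A i true  _ = ∃[ T ] (Viable A T × i ∈ T)
  LitCond A i false b = i ∉ A ⊎ ∃[ T ] (Viable A T × i ∈ T × CanViolate T b)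

  Consistent : Subset k → Set₂
  Consistent A = ∀ i → LitCond A i (sign (lit i)) (bound (lit i))

  module _ (𝓜 : WTS) (s : WTS.S 𝓜) (holds : ∀ i → 𝓜 ⊨⟨ s ⟩ modalForm (lit i)) where
    open WTS 𝓜 using (_⟶[_]_)

    successor-admissible : ∀ {w t T} → s ⟶[ w ] t → Realises 𝓜 t T → Admissible T (proj₁ w)
    successor-admissible {w} {T = T} s⟶t t✓ =
      admissible⁺ (proj₂ w) λ i∈T → ⊨⇒respects (lit _) (holds _) s⟶t (to (t✓ _) i∈T)

    module _ (A : Subset k) (A✓ : ∀ i → i ∈ A ⇔ HasSuccessor 𝓜 s (ψ i)) where

      successor-viable : ∀ {w t T} → s ⟶[ w ] t → Realises 𝓜 t T → Viable A T
      successor-viable {T = T} s⟶t t✓ =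
        (λ i∈T → from (A✓ _) (_ , _ , s⟶t , to (t✓ _) i∈T)) ,
        Weights.contains⇒nonEmpty T (successor-admissible {T = T} s⟶t t✓) ,
        (𝓜 , _ , to realises⇔typeForms t✓)

      ⊨⇒¬¬litCond : ∀ i σ b → 𝓜 ⊨⟨ s ⟩ signed σ (boundedForm b (ψ i)) → ¬ ¬ LitCond A i σ b
      ⊨⇒¬¬litCond i true b h =
        let (w , t , s⟶t , t✓) = proj₁ (to (⊨-bounded b) h) in
        ¬¬-map (λ (T , T✓) → T , successor-viable s⟶t T✓ , from (T✓ i) t✓)
               (¬¬-comprehension (λ j → 𝓜 ⊨⟨ t ⟩ ψ j))
      -- Claim i ∉ A; a proof of i ∈ A supplies a ψ i-successor, and a ψ i-successor whose
      -- weight violates b then yields the other disjunct instead.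
      ⊨⇒¬¬litCond i false b h k = k (inj₁ λ i∈A → h (from (⊨-bounded b) (to (A✓ i) i∈A , respected)))
        where
        respected : ∀ w t → s ⟶[ w ] t → 𝓜 ⊨⟨ t ⟩ ψ i → ¬ Violates b (proj₁ w)
        respected w t s⟶t t✓ violated = ¬¬-comprehension (λ j → 𝓜 ⊨⟨ t ⟩ ψ j) λ (T , T✓) →
          k (inj₂ (T , successor-viable s⟶t T✓ , from (T✓ i) t✓ ,
                   Weights.contains⇒canViolate T b (successor-admissible {T = T} s⟶t T✓) violated))

    ⊨⇒¬¬consistent : ¬ ¬ (∃[ A ] Consistent A)
    ⊨⇒¬¬consistent k = ¬¬-comprehension (λ i → HasSuccessor 𝓜 s (ψ i)) λ (A , A✓) →
      ¬¬-shift (λ i → ⊨⇒¬¬litCond A A✓ i _ _ (holds i)) (λ A-consistent → k (A , A-consistent))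

  module _ (decSat : ∀ T → Dec (Satisfiable⋀ (typeForms T))) where

    viable? : ∀ A T → Dec (Viable A T)
    viable? A T = T ⊆? A ×-dec Weights.nonEmpty? T ×-dec decSat T

    litCond? : ∀ A i σ b → Dec (LitCond A i σ b)
    litCond? A i true  _ = anySubset? λ T → viable? A T ×-dec i ∈? T
    litCond? A i false b =
      ¬? (i ∈? A) ⊎-dec anySubset? λ T → viable? A T ×-dec i ∈? T ×-dec Weights.canViolate? T b

    consistent? : Dec (∃[ A ] Consistent A)
    consistent? = anySubset? λ A → all? λ i → litCond? A i _ _

    module Model (A : Subset k) (ℓ₀ : AP → Set) where

      component : ∀ T → True (decSat T) → WTS
      component T sat = proj₁ (toWitness sat)

      point : ∀ T sat → WTS.S (component T sat)
      point T sat = proj₁ (proj₂ (toWitness sat))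

      data State : Set where
        root : State
        at   : ∀ T sat → WTS.S (component T sat) → State

      -- ℝ≥0 is large, so the weight is a parameter and a root edge fixes it only up to _≃ℚ_.
      data Edge (w : ℝ≥0) : State → State → Set where
        within   : ∀ {T sat s t} → WTS._⟶[_]_ (component T sat) s w t → Edge w (at T sat s) (at T sat t)
        fromRoot : ∀ {T} → T ⊆ A → (sat : True (decSat T)) → (q : ℚ) → Admissible T (fromℚ q) →
                   proj₁ w ≃ℚ q → Edge w root (at T sat (point T sat))

      label : State → AP → Set
      label root         = ℓ₀
      label (at T sat s) = WTS.ℓ (component T sat) s

      model : WTS
      model = record { S = State ; _⟶[_]_ = λ s w t → Edge w s t ; ℓ = label ; nonempty = root }

      embedding : ∀ T sat → BoundedMorphism (component T sat) model
      embedding T sat = record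
        { ⟦_⟧   = at T sat
        ; label = λ _ _ → mk⇔ id id
        ; forth = within
        ; back  = λ { (within s⟶t) → _ , s⟶t , refl }
        }

      point-realises : ∀ T sat → Realises model (at T sat (point T sat)) T
      point-realises T sat i = ⇔-trans (from realises⇔typeForms (proj₂ (proj₂ (toWitness sat))) i)
                                       (⊨-preserved (embedding T sat) (ψ i))

      viable-successor : ∀ {T i} → Viable A T → i ∈ T → (q : ℚ) (q✓ : Admissible T (fromℚ q)) →
        Σ[ t ∈ State ] (Edge (fromℚ q , Weights.Contains.nonNegative {T} q✓) root t × model ⊨⟨ t ⟩ ψ i)
      viable-successor {T} (T⊆A , _ , sat) i∈T q q✓ =
        _ , fromRoot T⊆A (fromWitness sat) q q✓ (fromℚ-≃ℚ q) , to (point-realises T _ _) i∈T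

      root-successor-∈ : ∀ {i w t} → Edge w root t → model ⊨⟨ t ⟩ ψ i → i ∈ A
      root-successor-∈ (fromRoot {T} T⊆A sat _ _ _) t✓ = T⊆A (from (point-realises T sat _) t✓)

      root-respects : ∀ i → sign (lit i) ≡ true → ∀ w t → Edge w root t →
                      model ⊨⟨ t ⟩ ψ i → ¬ Violates (bound (lit i)) (proj₁ w)
      root-respects i positive w _ (fromRoot {T} _ sat q q✓ w≃q) t✓ violated =
        respects⇒¬violates (lit i) positive (admissible⁻ q✓ (from (point-realises T sat i) t✓))
          (≃ℚ-violates (bound (lit i)) w≃q violated)

      -- Generalised over the sign and bound of lit i so that they can be split on.
      litCond⇒root-⊨ : ∀ i σ b →
        (σ ≡ true → ∀ w t → Edge w root t → model ⊨⟨ t ⟩ ψ i → ¬ Violates b (proj₁ w)) →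
        LitCond A i σ b → model ⊨⟨ root ⟩ signed σ (boundedForm b (ψ i))
      litCond⇒root-⊨ i true b respected (T , T✓ , i∈T) =
        from (⊨-bounded b)
          ((_ , viable-successor T✓ i∈T _ (Weights.contains-least T (proj₁ (proj₂ T✓)))) , respected refl)
      litCond⇒root-⊨ i false b _ (inj₁ i∉A) root✓ =
        let (_ , _ , root⟶t , t✓) = proj₁ (to (⊨-bounded b) root✓) in i∉A (root-successor-∈ root⟶t t✓)
      litCond⇒root-⊨ i false b _ (inj₂ (T , T✓ , i∈T , violable)) root✓ =
        let (q , q✓ , violated) = Weights.violatingPoint T b (proj₁ (proj₂ T✓)) violable
            (t , root⟶t , t✓)   = viable-successor T✓ i∈T q q✓
        in proj₂ (to (⊨-bounded b) root✓) _ t root⟶t t✓ violated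

      root-⊨ : Consistent A → ∀ i → model ⊨⟨ root ⟩ modalForm (lit i)
      root-⊨ A✓ i = litCond⇒root-⊨ i (sign (lit i)) (bound (lit i)) (root-respects i) (A✓ i)

-- Deciding satisfiability

AtomsConsistent : Branch → Set
AtomsConsistent b = All (_∉ᴸ posAtoms b) (negAtoms b)

module _ (b : Branch) where
  open LocalStep (lookup (modalLits b))

  branch-sound : (decSat : ∀ T → Dec (Satisfiable⋀ (typeForms T))) →
                 AtomsConsistent b → ∀ {A} → Consistent A → Satisfiable⋀ (map litForm b)
  branch-sound decSat atoms✓ {A} A✓ = model , root , All.map⁺ (All-join b pos✓ neg✓ modal✓)
    where
    open Model decSat A (_∈ᴸ posAtoms b)
    pos✓ : All (λ p → model ⊨⟨ root ⟩ atom p) (posAtoms b)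
    pos✓ = All.tabulate lift
    neg✓ : All (λ p → model ⊨⟨ root ⟩ (¬' atom p)) (negAtoms b)
    neg✓ = All.map (λ p∉ p∈ → p∉ (lower p∈)) atoms✓
    modal✓ : All (λ m → model ⊨⟨ root ⟩ modalForm m) (modalLits b)
    modal✓ = subst (All _) (tabulate-lookup (modalLits b)) (All.tabulate⁺ (root-⊨ A✓))

  branch-complete : Satisfiable⋀ (map litForm b) → ¬ ¬ (AtomsConsistent b × ∃[ A ] Consistent A)
  branch-complete (𝓜 , s , b✓) =
    ¬¬-map (atoms✓ ,_) (⊨⇒¬¬consistent 𝓜 s (All.lookup modal✓ ∘ ∈-lookup))
    where
    lits✓ : Holds 𝓜 s b
    lits✓ = All.map⁻ b✓
    modal✓ : All (λ m → 𝓜 ⊨⟨ s ⟩ modalForm m) (modalLits b)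
    modal✓ = All-modalLits lits✓
    atoms✓ : AtomsConsistent b
    atoms✓ = All.map (λ ¬p p∈ → ¬p (All.lookup (All-posAtoms lits✓) p∈)) (All-negAtoms lits✓)

  branch? : (∀ T → Dec (Satisfiable⋀ (typeForms T))) → Dec (Satisfiable⋀ (map litForm b))
  branch? decSat = map-¬¬ (λ (atoms✓ , _ , A✓) → branch-sound decSat atoms✓ A✓) branch-complete
    (All.all? (λ p → ¬? (p ∈ᴸ? posAtoms b)) (negAtoms b) ×-dec consistent? decSat)

singleton : WTS
singleton = record { S = ⊤ ; _⟶[_]_ = λ _ _ _ → ⊥ ; ℓ = λ _ _ → ⊥ ; nonempty = tt }

decide⋀ : ∀ n Γ → All (λ φ → depth φ ℕ.< n) Γ → Dec (Satisfiable⋀ Γ)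
decide⋀ zero    []      []      = yes (singleton , tt , [])
decide⋀ (suc n) Γ       Γ-depth =
  map-¬¬ (someBranch⇒satisfiable Γ) (satisfiable⇒¬¬someBranch Γ)
    (any-dec (All.map decideBranch (expand⋀-shallow Γ-depth)))
  where
  decideBranch : ∀ {b} → All Shallow b → Dec (Satisfiable⋀ (map litForm b))
  decideBranch {b} b-depth =
    branch? b λ T → decide⋀ n (typeForms T) (typeForms-depth (modalLits-depth b-depth) T)
    where open LocalStep (lookup (modalLits b))

theorem5p8 : (φ : Form) → Dec (Satisfiable φ)
theorem5p8 φ = map′ (λ { (𝓜 , s , φ✓ ∷ []) → 𝓜 , s , φ✓ }) (λ (𝓜 , s , φ✓) → 𝓜 , s , φ✓ ∷ [])
                    (decide⋀ (suc (depth φ)) [ φ ] (ℕ.≤-refl ∷ []))
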